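{- Let $r,p,q,n$ be positive integers with $p,q$ dividing $r$ and $pq$ dividing $rn$. The group $G(r,p,q,n)$ has no antisymmetric absolute involutions if and only if (i) $q$ is odd, or (ii) $n$ is odd, or (iii) $r\equiv p\equiv q\equiv n\equiv 2\pmod 4$.
   Context: Let $\zeta_r=\exp(2\pi\sqrt{ -1}/r)$, $\mathbb{Z}_r=\mathbb{Z}/r\mathbb{Z}$. $G(r,n)$ is the group of $n\times n$ complex matrices with exactly one nonzero entry in each row and column, each an $r$th root of unity; elements are written $(\pi,x)$, meaning the matrix whose $i$th column has $\zeta_r^{x_i}$ in row $\pi(i)$. Put $\Delta(\pi,x)=\sum_ix_i$. For $p\mid r$, $G(r,p,n)=\{g:\Delta(g)\in p\mathbb{Z}_r\}$. Let $c=\zeta_rI_n$; when $p,q\mid r$ and $pq\mid rn$, $C_q=\langle c^{r/q}\rangle$ is central of order $q$ in $G(r,p,n)$ and $G(r,p,q,n)=G(r,p,n)/C_q$. Let $\tau$ be the automorphism $(\pi,x)\mapsto(\pi,-x)$ of $G(r,p,q,n)$ (induced by inverse transpose). An absolute involution is an $\omega\in G(r,p,q,n)$ with $\omega^{ -1}=\tau(\omega)$; it is antisymmetric if $q$ is even and its preimages in $G(r,p,n)$ are antisymmetric matrices ($M^T=-M$). -}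

module Defs where

open import Data.Nat as ℕ using (ℕ; NonZero; _%_)
open import Data.Nat.Divisibility as ℕD using ()
open import Data.Integer as ℤ using (ℤ; +_; _+_; _-_; -_; _*_)
open import Data.Integer.Divisibility using (_∣_)
open import Data.Fin using (Fin; zero; suc; _≟_)
open import Data.Fin.Permutation using (Permutation′; _⟨$⟩ʳ_; _⟨$⟩ˡ_; _∘ₚ_; id)
open import Data.Maybe using (Maybe; just; nothing)
open import Data.Product using (_×_; ∃; Σ)
open import Data.Unit using (⊤)
open import Data.Empty using (⊥)
open import Relation.Nullary using (¬_; yes; no)
open import Relation.Binary.PropositionalEquality using (_≡_)

_≡_[mod_] : ℤ → ℤ → ℕ → Set
a ≡ b [mod m ] = (+ m) ∣ (a - b)

-- Element (π , x) of G(r,n): the n×n matrix whose i-th column has ζ_r^{x i}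
-- in row π(i) (and zeros elsewhere).  Exponents are integers read mod r.
record GElem (n : ℕ) : Set where
  constructor ⟨_,_⟩
  field
    perm : Permutation′ n
    exps : Fin n → ℤ
open GElem public

GEq : ∀ {n} → ℕ → GElem n → GElem n → Set
GEq r g h = (∀ i → perm g ⟨$⟩ʳ i ≡ perm h ⟨$⟩ʳ i)
          × (∀ i → exps g i ≡ exps h i [mod r ])

-- Matrix product: (π,x)(σ,y) = (π∘σ , i ↦ y i + x (σ i)).
mul : ∀ {n} → GElem n → GElem n → GElem n
mul ⟨ π , x ⟩ ⟨ σ , y ⟩ = ⟨ σ ∘ₚ π , (λ i → y i + x (σ ⟨$⟩ʳ i)) ⟩

inv : ∀ {n} → GElem n → GElem n
inv ⟨ π , x ⟩ = ⟨ Data.Fin.Permutation.flip π , (λ i → - x (π ⟨$⟩ˡ i)) ⟩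

-- τ(π,x) = (π,-x)  (inverse transpose).
tau : ∀ {n} → GElem n → GElem n
tau ⟨ π , x ⟩ = ⟨ π , (λ i → - x i) ⟩

cpow : ∀ {n} → ℤ → GElem n
cpow m = ⟨ id , (λ _ → m) ⟩

sumFin : ∀ {n} → (Fin n → ℤ) → ℤ
sumFin {ℕ.zero} f = + 0
sumFin {ℕ.suc n} f = f zero + sumFin (λ i → f (suc i))

Δ : ∀ {n} → GElem n → ℤ
Δ g = sumFin (exps g)

InGrpn : ∀ {n} → ℕ → GElem n → Set
InGrpn p g = (+ p) ∣ Δ g

cq : ∀ {n} (r q : ℕ) .{{_ : NonZero q}} → GElem n
cq r q = cpow (+ (r ℕ./ q))

-- An element ω of G(r,p,q,n) = G(r,p,n)/C_q is given by a representative
-- g ∈ G(r,p,n).  ω is an absolute involution iff ω⁻¹ = τ(ω) in the quotient,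
-- i.e. g⁻¹ = τ(g)·c^{k r/q} in G(r,n) for some k.
AbsInv : ∀ {n} (r q : ℕ) .{{_ : NonZero q}} → GElem n → Set
AbsInv r q g = ∃ λ (k : ℕ) → GEq r (inv g) (mul (tau g) (cpow (+ k * + (r ℕ./ q))))

-- Matrix entries.  Every entry of M or -M, for M ∈ G(r,n), lies in
-- {0} ∪ μ_{2r}; we encode 0 as nothing and ζ_{2r}^e as just e (e mod 2r).
-- Thus ζ_r^a = just (2a) and -ζ_{2r}^e = ζ_{2r}^{e+r}.
Entry : Set
Entry = Maybe ℤ

EntryEq : ℕ → Entry → Entry → Set
EntryEq r nothing nothing = ⊤
EntryEq r (just u) (just v) = u ≡ v [mod 2 ℕ.* r ]
EntryEq r _ _ = ⊥

negE : ℕ → Entry → Entry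
negE r nothing = nothing
negE r (just u) = just (u + + r)

entry : ∀ {n} → GElem n → Fin n → Fin n → Entry
entry g a b with a ≟ (perm g ⟨$⟩ʳ b)
... | yes _ = just (+ 2 * exps g b)
... | no _ = nothing

AntisymMat : ∀ {n} → ℕ → GElem n → Set
AntisymMat r g = ∀ a b → EntryEq r (entry g b a) (negE r (entry g a b))

-- ω (represented by g) is antisymmetric: q is even and every preimage
-- g·c^{k r/q} of ω in G(r,p,n) is an antisymmetric matrix.
Antisym : ∀ {n} (r q : ℕ) .{{_ : NonZero q}} → GElem n → Set
Antisym r q g = (2 ℕD.∣ q) × (∀ (k : ℕ) → AntisymMat r (mul g (cpow (+ k * + (r ℕ./ q)))))

HasAntisymAbsInv : (r p q n : ℕ) .{{_ : NonZero q}} → Set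
HasAntisymAbsInv r p q n =
  Σ (GElem n) λ g → InGrpn p g × AbsInv r q g × Antisym r q g

-- An element (π , x) of G(r,n) has an antisymmetric matrix exactly when π is an involution and
-- ζ_r^{x (π b)} = -ζ_r^{x b}, i.e. r = 2h and x (π b) ≡ x b + h (mod r); as the differences
-- x (π b) - x b are unchanged by scalars, this holds for all preimages at once, and such an element
-- is automatically an absolute involution with central factor c^{r/2} = c^{(q/2)(r/q)}.
-- Summing the congruence over b gives n h ≡ 0 (mod 2h), so n is even; if h and n/2 are odd,
-- partners have exponents of opposite parity, so Δ ≡ n/2 is odd and p cannot be even.
-- Conversely, for q and n even, the involution 2i ↔ 2i+1 with exponents (y_i , y_i + h) has
-- Δ = 2 Σ y + (n/2) h, which a suitable y makes divisible by p unless p is even and (n/2) h is odd;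
-- as p and q divide r = 2h, that exceptional case is exactly r ≡ p ≡ q ≡ n ≡ 2 (mod 4).

module Submission where

open import Defs

open import Algebra.Properties.CommutativeSemigroup using (interchange)
import Algebra.Properties.CommutativeMonoid.Sum as MonoidSum
open import Data.Empty using (⊥; ⊥-elim)
open import Data.Fin using (Fin; zero; suc; _≟_)
open import Data.Fin.Permutation using (Permutation′; _⟨$⟩ʳ_; _⟨$⟩ˡ_; permutation; inverseˡ)
open import Data.Integer as ℤ using (ℤ; +_; _+_; _-_; -_)
open import Data.Integer.DivMod using (_%ℕ_; _/ℕ_; n%ℕd<d; a≡a%ℕn+[a/ℕn]*n)
open import Data.Integer.Divisibility.Signed as ℤ∣
  using (divides; ∣ᵤ⇒∣; ∣⇒∣ᵤ) renaming (_∣_ to _∣ℤ_)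
import Data.Integer.Properties as ℤ
open import Data.Integer.Tactic.RingSolver as ℤ using ()
open import Data.Maybe using (just)
open import Data.Nat as ℕ using (ℕ; NonZero; zero; suc; _*_; _%_; _/_; s≤s)
open import Data.Nat.DivMod using (m≡m%n+[m/n]*n; m%n<n; [m+kn]%n≡m%n; m*n%n≡0; m/n*n≡m)
open import Data.Nat.Divisibility
  using (_∣_; divides; _∣?_; ∣-trans; ∣m⇒∣m*n; ∣n⇒∣m*n; *-cancelʳ-∣)
import Data.Nat.Properties as ℕ
open import Data.Nat.Tactic.RingSolver as ℕ using ()
open import Data.Product using (_×_; _,_; ∃)
open import Data.Sum using (_⊎_; inj₁; inj₂)
open import Data.Unit using (tt)
open import Data.Vec.Functional using (_∷_)
open import Function.Base using (_∘_)
open import Function.Bundles using (_⇔_; mk⇔; module Equivalence)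
open import Relation.Binary.PropositionalEquality
  using (_≡_; refl; sym; trans; cong; cong₂; subst; subst₂; _≗_; module ≡-Reasoning)
open import Relation.Nullary using (¬_; Dec; yes; no)

sumFin-cong : ∀ {n} {f g : Fin n → ℤ} → f ≗ g → sumFin f ≡ sumFin g
sumFin-cong {zero} _ = refl
sumFin-cong {suc n} f≗g = cong₂ _+_ (f≗g zero) (sumFin-cong (f≗g ∘ suc))

sumFin-+ : ∀ {n} (f g : Fin n → ℤ) → sumFin (λ i → f i + g i) ≡ sumFin f + sumFin g
sumFin-+ {zero} f g = refl
sumFin-+ {suc n} f g = trans (cong (_+_ (f zero + g zero)) (sumFin-+ (f ∘ suc) (g ∘ suc)))
  (interchange ℤ.+-commutativeSemigroup (f zero) (g zero) (sumFin (f ∘ suc)) (sumFin (g ∘ suc)))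

sumFin-const : ∀ n c → sumFin {n} (λ _ → c) ≡ + n ℤ.* c
sumFin-const zero c = sym (ℤ.*-zeroˡ c)
sumFin-const (suc n) c = trans (cong (_+_ c) (sumFin-const n c)) (sym (ℤ.suc-* (+ n) c))

sumFin-permute : ∀ {n} (f : Fin n → ℤ) (σ : Permutation′ n) →
  sumFin (λ i → f (σ ⟨$⟩ʳ i)) ≡ sumFin f
sumFin-permute {n} f σ =
  trans (sumFin≡sum (λ i → f (σ ⟨$⟩ʳ i))) (trans (sym (sum-permute {n} {n} f σ)) (sym (sumFin≡sum f)))
  where
  open MonoidSum ℤ.+-0-commutativeMonoid using (sum; sum-permute)
  sumFin≡sum : ∀ {n} (f : Fin n → ℤ) → sumFin f ≡ sum f
  sumFin≡sum {zero} f = refl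
  sumFin≡sum {suc n} f = cong (_+_ (f zero)) (sumFin≡sum (f ∘ suc))

sumFin-cong-∣ : ∀ {n} d {f g : Fin n → ℤ} → (∀ i → d ∣ℤ f i - g i) → d ∣ℤ sumFin f - sumFin g
sumFin-cong-∣ {zero} d _ = divides (+ 0) (sym (ℤ.*-zeroˡ d))
sumFin-cong-∣ {suc n} d {f} {g} d∣f-g = subst (d ∣ℤ_) (sym (regroup (f zero) _ (g zero) _))
  (ℤ∣.∣m∣n⇒∣m+n (d∣f-g zero) (sumFin-cong-∣ d (d∣f-g ∘ suc)))
  where
  regroup : ∀ a A b B → (a + A) - (b + B) ≡ (a - b) + (A - B)
  regroup = ℤ.solve-∀

sumFin-pairs : ∀ {n} (f : Fin n → ℤ) (σ : Permutation′ n) {c} → (∀ i → f (σ ⟨$⟩ʳ i) + f i ≡ c) →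
  sumFin f + sumFin f ≡ + n ℤ.* c
sumFin-pairs {n} f σ {c} pair = begin
  sumFin f + sumFin f                     ≡⟨ cong (_+ sumFin f) (sym (sumFin-permute f σ)) ⟩
  sumFin (λ i → f (σ ⟨$⟩ʳ i)) + sumFin f  ≡⟨ sym (sumFin-+ (λ i → f (σ ⟨$⟩ʳ i)) f) ⟩
  sumFin (λ i → f (σ ⟨$⟩ʳ i) + f i)       ≡⟨ sumFin-cong pair ⟩
  sumFin {n} (λ _ → c)                    ≡⟨ sumFin-const n c ⟩
  + n ℤ.* c                               ∎
  where open ≡-Reasoning

parity : ℤ → ℤ
parity a = + (a %ℕ 2)

parity≡[mod2] : ∀ a → + 2 ∣ℤ parity a - a
parity≡[mod2] a = subst (λ a′ → + 2 ∣ℤ parity a - a′) (sym (a≡a%ℕn+[a/ℕn]*n a 2))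
  (divides (- (a /ℕ 2)) (remove (parity a) (a /ℕ 2)))
  where
  remove : ∀ c k → c - (c + k ℤ.* + 2) ≡ - k ℤ.* + 2
  remove = ℤ.solve-∀

same-parity⇒even-difference : ∀ {a b} c {k l} → a ≡ c + k ℤ.* + 2 → b ≡ c + l ℤ.* + 2 →
  + 2 ∣ℤ a - b
same-parity⇒even-difference c {k} {l} refl refl = divides (k - l) (difference c k l)
  where
  difference : ∀ c k l → (c + k ℤ.* + 2) - (c + l ℤ.* + 2) ≡ (k - l) ℤ.* + 2
  difference = ℤ.solve-∀

¬2∣a-b⇒parity-sum≡1 : ∀ a b → ¬ (+ 2 ∣ℤ a - b) → parity a + parity b ≡ + 1
¬2∣a-b⇒parity-sum≡1 a b a-b-odd
  with a %ℕ 2 | n%ℕd<d a 2 | a≡a%ℕn+[a/ℕn]*n a 2 | b %ℕ 2 | n%ℕd<d b 2 | a≡a%ℕn+[a/ℕn]*n b 2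
... | 0 | _ | a≡ | 0 | _ | b≡ =
  ⊥-elim (a-b-odd (same-parity⇒even-difference (+ 0) {a /ℕ 2} {b /ℕ 2} a≡ b≡))
... | 1 | _ | a≡ | 1 | _ | b≡ =
  ⊥-elim (a-b-odd (same-parity⇒even-difference (+ 1) {a /ℕ 2} {b /ℕ 2} a≡ b≡))
... | 0 | _ | _ | 1 | _ | _ = refl
... | 1 | _ | _ | 0 | _ | _ = refl
... | suc (suc _) | s≤s (s≤s ()) | _ | _ | _ | _
... | _ | _ | _ | suc (suc _) | s≤s (s≤s ()) | _

¬2∣m⇒m≡1+[m/2]*2 : ∀ {m} → ¬ 2 ∣ m → m ≡ 1 ℕ.+ (m / 2) * 2
¬2∣m⇒m≡1+[m/2]*2 {m} m-odd with m % 2 | m%n<n m 2 | m≡m%n+[m/n]*n m 2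
... | 0 | _ | m≡ = ⊥-elim (m-odd (divides (m / 2) m≡))
... | 1 | _ | m≡ = m≡
... | suc (suc _) | s≤s (s≤s ()) | _

[m*2]%4≡2⇔¬2∣m : ∀ m → (m * 2) % 4 ≡ 2 ⇔ (¬ 2 ∣ m)
[m*2]%4≡2⇔¬2∣m m = mk⇔
  (λ { m*2%4≡2 (divides k refl) → 0≢2 (trans (sym (k*4%4≡0 k)) m*2%4≡2) })
  (λ m-odd → trans (cong (_% 4) (trans (cong (_* 2) (¬2∣m⇒m≡1+[m/2]*2 m-odd)) (expand (m / 2))))
                   ([m+kn]%n≡m%n 2 (m / 2) 4))
  where
  k*4%4≡0 : ∀ k → (k * 2 * 2) % 4 ≡ 0
  k*4%4≡0 k = trans (cong (_% 4) (ℕ.*-assoc k 2 2)) (m*n%n≡0 k 4)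
  0≢2 : ¬ 0 ≡ 2
  0≢2 ()
  expand : ∀ k → (1 ℕ.+ k * 2) * 2 ≡ 2 ℕ.+ k * 4
  expand = ℕ.solve-∀

m%4≡2⇒2∣m : ∀ m → m % 4 ≡ 2 → 2 ∣ m
m%4≡2⇒2∣m m m%4≡2 = divides (1 ℕ.+ (m / 4) * 2)
  (trans (m≡m%n+[m/n]*n m 4) (trans (cong (ℕ._+ (m / 4) * 4) m%4≡2) (regroup (m / 4))))
  where
  regroup : ∀ k → 2 ℕ.+ k * 4 ≡ (1 ℕ.+ k * 2) * 2
  regroup = ℕ.solve-∀

half-divisor-odd : ∀ {d h} → d * 2 ∣ h * 2 → ¬ 2 ∣ h → ¬ 2 ∣ d
half-divisor-odd d*2∣h*2 h-odd 2∣d = h-odd (∣-trans 2∣d (*-cancelʳ-∣ 2 d*2∣h*2))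

r≡q′*[r/q]*2 : ∀ {r q} .{{_ : NonZero q}} q′ → q ∣ r → q ≡ q′ * 2 → r ≡ q′ * (r / q) * 2
r≡q′*[r/q]*2 {r} {q} q′ q∣r q≡q′*2 = begin
  r                  ≡⟨ sym (m/n*n≡m q∣r) ⟩
  r / q * q          ≡⟨ cong (r / q *_) q≡q′*2 ⟩
  r / q * (q′ * 2)   ≡⟨ rearrange (r / q) q′ ⟩
  q′ * (r / q) * 2   ∎
  where
  open ≡-Reasoning
  rearrange : ∀ t s → t * (s * 2) ≡ s * t * 2
  rearrange = ℕ.solve-∀

∃p∣2Y+c : ∀ p c → ¬ 2 ∣ p ⊎ 2 ∣ c → ∃ λ Y → + p ∣ℤ + 2 ℤ.* Y + + c
∃p∣2Y+c p c (inj₁ p-odd) = + s ℤ.* + c , divides (+ c) (begin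
  + 2 ℤ.* (+ s ℤ.* + c) + + c   ≡⟨ factor (+ s) (+ c) ⟩
  + c ℤ.* (+ 1 + + s ℤ.* + 2)   ≡⟨ cong (λ t → + c ℤ.* (+ 1 + t)) (sym (ℤ.pos-* s 2)) ⟩
  + c ℤ.* + (1 ℕ.+ s * 2)       ≡⟨ cong (λ t → + c ℤ.* + t) (sym (¬2∣m⇒m≡1+[m/2]*2 p-odd)) ⟩
  + c ℤ.* + p                   ∎)
  where
  open ≡-Reasoning
  s = p / 2
  factor : ∀ s c → + 2 ℤ.* (s ℤ.* c) + c ≡ c ℤ.* (+ 1 + s ℤ.* + 2)
  factor = ℤ.solve-∀
∃p∣2Y+c p c (inj₂ (divides w c≡w*2)) = - + w , divides (+ 0) (begin
  + 2 ℤ.* - + w + + c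
    ≡⟨ cong (λ t → + 2 ℤ.* - + w + t) (trans (cong +_ c≡w*2) (ℤ.pos-* w 2)) ⟩
  + 2 ℤ.* - + w + + w ℤ.* + 2   ≡⟨ cancel (+ w) ⟩
  + 0                           ≡⟨ sym (ℤ.*-zeroˡ (+ p)) ⟩
  + 0 ℤ.* + p                   ∎)
  where
  open ≡-Reasoning
  cancel : ∀ w → + 2 ℤ.* - w + w ℤ.* + 2 ≡ + 0
  cancel = ℤ.solve-∀

HalfTurn : ∀ {n} → ℕ → GElem n → Set
HalfTurn h g = ∀ b → + (h * 2) ∣ℤ exps g (perm g ⟨$⟩ʳ b) - (exps g b + + h)

Involutive : ∀ {n} → GElem n → Set
Involutive g = ∀ b → perm g ⟨$⟩ʳ (perm g ⟨$⟩ʳ b) ≡ b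

negated-entries⇔halfTurn : ∀ h a b →
  EntryEq (h * 2) (just (+ 2 ℤ.* a)) (negE (h * 2) (just (+ 2 ℤ.* b))) ⇔ (+ (h * 2) ∣ℤ a - (b + + h))
negated-entries⇔halfTurn h a b = mk⇔
  (λ d → ℤ∣.*-cancelˡ-∣ (+ 2) (subst₂ _∣ℤ_ modulus doubled (∣ᵤ⇒∣ d)))
  (λ d → ∣⇒∣ᵤ (subst₂ _∣ℤ_ (sym modulus) (sym doubled) (ℤ∣.*-monoʳ-∣ (+ 2) d)))
  where
  modulus : + (2 * (h * 2)) ≡ + 2 ℤ.* + (h * 2)
  modulus = ℤ.pos-* 2 (h * 2)
  factor : ∀ a b h → + 2 ℤ.* a - (+ 2 ℤ.* b + h ℤ.* + 2) ≡ + 2 ℤ.* (a - (b + h))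
  factor = ℤ.solve-∀
  doubled : + 2 ℤ.* a - (+ 2 ℤ.* b + + (h * 2)) ≡ + 2 ℤ.* (a - (b + + h))
  doubled = trans (cong (λ r → + 2 ℤ.* a - (+ 2 ℤ.* b + r)) (ℤ.pos-* h 2)) (factor a b (+ h))

antisymMat⇒halfTurn : ∀ {n} h (g : GElem n) → AntisymMat (h * 2) g → HalfTurn h g
antisymMat⇒halfTurn h g anti b with anti (perm g ⟨$⟩ʳ b) b
... | partners with perm g ⟨$⟩ʳ b ≟ perm g ⟨$⟩ʳ b | b ≟ perm g ⟨$⟩ʳ (perm g ⟨$⟩ʳ b)
... | yes _ | yes _ =
  Equivalence.to (negated-entries⇔halfTurn h (exps g (perm g ⟨$⟩ʳ b)) (exps g b)) partners
... | yes _ | no _ = ⊥-elim partners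
... | no π≢π | _ = ⊥-elim (π≢π refl)

halfTurn⇒antisymMat : ∀ {n} h (g : GElem n) → Involutive g → HalfTurn h g → AntisymMat (h * 2) g
halfTurn⇒antisymMat h g π-involutive turn a b with a ≟ perm g ⟨$⟩ʳ b | b ≟ perm g ⟨$⟩ʳ a
... | yes refl | yes _ =
  Equivalence.from (negated-entries⇔halfTurn h (exps g (perm g ⟨$⟩ʳ b)) (exps g b)) (turn b)
... | yes refl | no b≢ππb = ⊥-elim (b≢ππb (sym (π-involutive b)))
... | no a≢πb | yes refl = ⊥-elim (a≢πb (sym (π-involutive a)))
... | no _ | no _ = tt

halfTurn-cpow : ∀ {n} h (g : GElem n) c → HalfTurn h (mul g (cpow c)) ⇔ HalfTurn h g
halfTurn-cpow h g c = mk⇔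
  (λ turn b → subst (+ (h * 2) ∣ℤ_) (shift c (exps g (perm g ⟨$⟩ʳ b)) (exps g b) (+ h)) (turn b))
  (λ turn b → subst (+ (h * 2) ∣ℤ_) (sym (shift c (exps g (perm g ⟨$⟩ʳ b)) (exps g b) (+ h))) (turn b))
  where
  shift : ∀ c a b h → (c + a) - ((c + b) + h) ≡ a - (b + h)
  shift = ℤ.solve-∀

halfTurn⇒antisym : ∀ {n} h q .{{_ : NonZero q}} (g : GElem n) → 2 ∣ q → Involutive g → HalfTurn h g →
  Antisym (h * 2) q g
halfTurn⇒antisym h q g q-even π-involutive turn = q-even , λ k →
  let c = + k ℤ.* + ((h * 2) / q) in
  halfTurn⇒antisymMat h (mul g (cpow c)) π-involutive (Equivalence.from (halfTurn-cpow h g c) turn)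

-- τ(M) is the inverse transpose, so antisymmetry gives M⁻¹ = τ(Mᵀ) = τ(-M) = τ(M) c^{r/2}.
halfTurn⇒absInv : ∀ {n} h (g : GElem n) → Involutive g → HalfTurn h g →
  GEq (h * 2) (inv g) (mul (tau g) (cpow (+ h)))
halfTurn⇒absInv h g π-involutive turn = π⁻¹≡π , λ i →
  ∣⇒∣ᵤ (subst (λ j → + (h * 2) ∣ℤ - x j - (+ h + - x i)) (sym (π⁻¹≡π i))
    (subst (+ (h * 2) ∣ℤ_) (shift (x (π ⟨$⟩ʳ i)) (x i))
      (ℤ∣.∣m∣n⇒∣m-n (ℤ∣.∣m⇒∣-m (turn i)) ℤ∣.∣-refl)))
  where
  π = perm g
  x = exps g
  π⁻¹≡π : ∀ i → π ⟨$⟩ˡ i ≡ π ⟨$⟩ʳ i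
  π⁻¹≡π i = trans (cong (π ⟨$⟩ˡ_) (sym (π-involutive i))) (inverseˡ π)
  regroup : ∀ a b h → - (a - (b + h)) - h ℤ.* + 2 ≡ - a - (h + - b)
  regroup = ℤ.solve-∀
  shift : ∀ a b → - (a - (b + + h)) - + (h * 2) ≡ - a - (+ h + - b)
  shift a b = trans (cong (λ r → - (a - (b + + h)) - r) (ℤ.pos-* h 2)) (regroup a b (+ h))

halfTurn⇒even : ∀ {n} h .{{_ : NonZero h}} (g : GElem n) → HalfTurn h g → 2 ∣ n
halfTurn⇒even {n} h g turn =
  *-cancelʳ-∣ h (subst₂ _∣_ (ℕ.*-comm h 2) ∣Σ-difference∣
                         (∣⇒∣ᵤ (sumFin-cong-∣ (+ (h * 2)) turn)))
  where
  x = exps g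
  cancel : ∀ a b → a - (a + b) ≡ - b
  cancel = ℤ.solve-∀
  Σ-difference : sumFin (λ b → x (perm g ⟨$⟩ʳ b)) - sumFin (λ b → x b + + h) ≡ - (+ n ℤ.* + h)
  Σ-difference = begin
    sumFin (λ b → x (perm g ⟨$⟩ʳ b)) - sumFin (λ b → x b + + h)
      ≡⟨ cong₂ _-_ (sumFin-permute x (perm g)) (sumFin-+ x (λ _ → + h)) ⟩
    Δ g - (Δ g + sumFin {n} (λ _ → + h))   ≡⟨ cong (λ s → Δ g - (Δ g + s)) (sumFin-const n (+ h)) ⟩
    Δ g - (Δ g + + n ℤ.* + h)              ≡⟨ cancel (Δ g) _ ⟩
    - (+ n ℤ.* + h)                        ∎
    where open ≡-Reasoning
  ∣Σ-difference∣ : ℤ.∣ sumFin (λ b → x (perm g ⟨$⟩ʳ b)) - sumFin (λ b → x b + + h) ∣ ≡ n * h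
  ∣Σ-difference∣ =
    trans (cong ℤ.∣_∣ Σ-difference) (trans (ℤ.∣-i∣≡∣i∣ (+ n ℤ.* + h)) (ℤ.abs-* (+ n) (+ h)))

halfTurn⇒odd-differences : ∀ {n} h (g : GElem n) → ¬ 2 ∣ h → HalfTurn h g →
  ∀ b → ¬ (+ 2 ∣ℤ exps g (perm g ⟨$⟩ʳ b) - exps g b)
halfTurn⇒odd-differences h g h-odd turn b 2∣difference = h-odd (∣⇒∣ᵤ (subst (+ 2 ∣ℤ_)
  (cancel (exps g (perm g ⟨$⟩ʳ b)) (exps g b) (+ h))
  (ℤ∣.∣m∣n⇒∣m-n 2∣difference (ℤ∣.∣-trans (divides (+ h) (ℤ.pos-* h 2)) (turn b)))))
  where
  cancel : ∀ a b h → (a - b) - (a - (b + h)) ≡ h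
  cancel = ℤ.solve-∀

halfTurn⇒Δ-odd : ∀ {n} h M (g : GElem n) → ¬ 2 ∣ h → n ≡ M * 2 → ¬ 2 ∣ M → HalfTurn h g →
  ¬ (+ 2 ∣ℤ Δ g)
halfTurn⇒Δ-odd {n} h M g h-odd n≡M*2 M-odd turn 2∣Δ = M-odd (∣⇒∣ᵤ (subst (+ 2 ∣ℤ_) S≡M 2∣S))
  where
  S = sumFin (parity ∘ exps g)
  2∣S : + 2 ∣ℤ S
  2∣S = ℤ∣.∣m+n∣n⇒∣m (sumFin-cong-∣ (+ 2) (parity≡[mod2] ∘ exps g)) (ℤ∣.∣m⇒∣-m 2∣Δ)
  S+S≡n : S + S ≡ + n ℤ.* + 1
  S+S≡n = sumFin-pairs (parity ∘ exps g) (perm g)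
    (λ b → ¬2∣a-b⇒parity-sum≡1 (exps g (perm g ⟨$⟩ʳ b)) (exps g b)
                                (halfTurn⇒odd-differences h g h-odd turn b))
  twice : ∀ s → s ℤ.* + 2 ≡ s + s
  twice = ℤ.solve-∀
  S≡M : S ≡ + M
  S≡M = ℤ.*-cancelʳ-≡ S (+ M) (+ 2) (begin
    S ℤ.* + 2      ≡⟨ twice S ⟩
    S + S          ≡⟨ S+S≡n ⟩
    + n ℤ.* + 1    ≡⟨ ℤ.*-identityʳ (+ n) ⟩
    + n            ≡⟨ cong +_ n≡M*2 ⟩
    + (M * 2)      ≡⟨ ℤ.pos-* M 2 ⟩
    + M ℤ.* + 2    ∎)
    where open ≡-Reasoning

swap : ∀ m → Fin (m * 2) → Fin (m * 2)
swap (suc m) zero = suc zero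
swap (suc m) (suc zero) = zero
swap (suc m) (suc (suc i)) = suc (suc (swap m i))

swap-involutive : ∀ m i → swap m (swap m i) ≡ i
swap-involutive (suc m) zero = refl
swap-involutive (suc m) (suc zero) = refl
swap-involutive (suc m) (suc (suc i)) = cong (λ j → suc (suc j)) (swap-involutive m i)

pairing : ∀ m → Permutation′ (m * 2)
pairing m = permutation (swap m) (swap m) (swap-involutive m) (swap-involutive m)

pairExps : ∀ {m} → (Fin m → ℤ) → ℤ → Fin (m * 2) → ℤ
pairExps {suc m} y h zero = y zero
pairExps {suc m} y h (suc zero) = y zero + h
pairExps {suc m} y h (suc (suc i)) = pairExps (y ∘ suc) h i

pairExps-swap : ∀ {m} (y : Fin m → ℤ) h i →
  pairExps y h (swap m i) ≡ pairExps y h i + h ⊎ pairExps y h i ≡ pairExps y h (swap m i) + h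
pairExps-swap {suc m} y h zero = inj₁ refl
pairExps-swap {suc m} y h (suc zero) = inj₂ refl
pairExps-swap {suc m} y h (suc (suc i)) = pairExps-swap (y ∘ suc) h i

sumFin-pairExps : ∀ {m} (y : Fin m → ℤ) h → sumFin (pairExps y h) ≡ + 2 ℤ.* sumFin y + + m ℤ.* h
sumFin-pairExps {zero} y h = refl
sumFin-pairExps {suc m} y h =
  trans (cong (λ s → y zero + (y zero + h + s)) (sumFin-pairExps (y ∘ suc) h))
        (regroup (y zero) h (sumFin (y ∘ suc)) (+ m))
  where
  regroup : ∀ a h s m → a + (a + h + (+ 2 ℤ.* s + m ℤ.* h)) ≡ + 2 ℤ.* (a + s) + (+ 1 + m) ℤ.* h
  regroup = ℤ.solve-∀

pairElem : ∀ {m} → (Fin m → ℤ) → ℤ → GElem (m * 2)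
pairElem {m} y h = ⟨ pairing m , pairExps y h ⟩

pairElem-halfTurn : ∀ {m} (y : Fin m → ℤ) h → HalfTurn h (pairElem y (+ h))
pairElem-halfTurn {m} y h b with pairExps-swap y (+ h) b
... | inj₁ up = divides (+ 0) (trans (cong (_- (x b + + h)) up) (ℤ.+-inverseʳ (x b + + h)))
  where x = pairExps y (+ h)
... | inj₂ down = divides (- + 1) (begin
    x (swap m b) - (x b + + h)                ≡⟨ cong (λ a → x (swap m b) - (a + + h)) down ⟩
    x (swap m b) - (x (swap m b) + + h + + h) ≡⟨ lower (x (swap m b)) (+ h) ⟩
    - + 1 ℤ.* (+ h ℤ.* + 2)                   ≡⟨ cong (λ r → - + 1 ℤ.* r) (sym (ℤ.pos-* h 2)) ⟩
    - + 1 ℤ.* + (h * 2)                       ∎)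
  where
  open ≡-Reasoning
  x = pairExps y (+ h)
  lower : ∀ a h → a - (a + h + h) ≡ - + 1 ℤ.* (h ℤ.* + 2)
  lower = ℤ.solve-∀

∃pairElem-p∣Δ : ∀ p m h → ¬ 2 ∣ p ⊎ 2 ∣ m * h →
  ∃ λ (y : Fin m → ℤ) → + p ∣ℤ Δ (pairElem y (+ h))
∃pairElem-p∣Δ p zero h _ = (λ ()) , divides (+ 0) (sym (ℤ.*-zeroˡ (+ p)))
∃pairElem-p∣Δ p (suc m) h cond with ∃p∣2Y+c p (suc m * h) cond
... | Y , p∣ = y , subst (+ p ∣ℤ_) (sym Δ≡) p∣
  where
  y : Fin (suc m) → ℤ
  y = Y ∷ λ _ → + 0
  Σy≡Y : sumFin y ≡ Y
  Σy≡Y = trans (cong (_+_ Y) (trans (sumFin-const m (+ 0)) (ℤ.*-zeroʳ (+ m)))) (ℤ.+-identityʳ Y)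
  Δ≡ : Δ (pairElem y (+ h)) ≡ + 2 ℤ.* Y + + (suc m * h)
  Δ≡ = trans (sumFin-pairExps y (+ h)) (cong₂ (λ s t → + 2 ℤ.* s + t) Σy≡Y (sym (ℤ.pos-* (suc m) h)))

pairElem-hasAntisymAbsInv : ∀ {r} p q .{{_ : NonZero q}} h k {m} (y : Fin m → ℤ) →
  r ≡ h * 2 → k * (r / q) ≡ h → 2 ∣ q → + p ∣ℤ Δ (pairElem y (+ h)) →
  HasAntisymAbsInv r p q (m * 2)
pairElem-hasAntisymAbsInv p q h k {m} y refl k*r/q≡h q-even p∣Δ =
  g , ∣⇒∣ᵤ p∣Δ , (k , absInv) , halfTurn⇒antisym h q g q-even (swap-involutive m) turn
  where
  g = pairElem y (+ h)
  turn : HalfTurn h g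
  turn = pairElem-halfTurn y h
  absInv : GEq (h * 2) (inv g) (mul (tau g) (cpow (+ k ℤ.* + ((h * 2) / q))))
  absInv = subst (λ c → GEq (h * 2) (inv g) (mul (tau g) (cpow c)))
                 (trans (cong +_ (sym k*r/q≡h)) (ℤ.pos-* k _))
                 (halfTurn⇒absInv h g (swap-involutive m) turn)

Obstruction : ℕ → ℕ → ℕ → ℕ → Set
Obstruction r p q n =
  (¬ (2 ∣ q)) ⊎ (¬ (2 ∣ n)) ⊎ ((r % 4 ≡ 2) × (p % 4 ≡ 2) × (q % 4 ≡ 2) × (n % 4 ≡ 2))

obstruction⇒¬hasAntisymAbsInv : ∀ r p q n .{{_ : NonZero r}} .{{_ : NonZero q}} → q ∣ r →
  Obstruction r p q n → ¬ HasAntisymAbsInv r p q n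
obstruction⇒¬hasAntisymAbsInv r p q n q∣r obstruction (g , p∣Δ , _ , q-even , antisym)
  with ∣-trans q-even q∣r
... | divides h refl = contradiction obstruction
  where
  instance
    h≢0 : NonZero h
    h≢0 = ℕ.m*n≢0⇒m≢0 h
  turn : HalfTurn h g
  turn = Equivalence.to (halfTurn-cpow h g c) (antisymMat⇒halfTurn h (mul g (cpow c)) (antisym 0))
    where c = + 0 ℤ.* + ((h * 2) / q)
  n-even : 2 ∣ n
  n-even = halfTurn⇒even h g turn
  contradiction : Obstruction (h * 2) p q n → ⊥
  contradiction (inj₁ q-odd) = q-odd q-even
  contradiction (inj₂ (inj₁ n-odd)) = n-odd n-even
  contradiction (inj₂ (inj₂ (r%4≡2 , p%4≡2 , _ , n%4≡2))) with n-even
  ... | divides M n≡M*2 = halfTurn⇒Δ-odd h M g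
    (Equivalence.to ([m*2]%4≡2⇔¬2∣m h) r%4≡2) n≡M*2
    (Equivalence.to ([m*2]%4≡2⇔¬2∣m M) (subst (λ n → n % 4 ≡ 2) n≡M*2 n%4≡2)) turn
    (ℤ∣.∣-trans (∣ᵤ⇒∣ {+ 2} {+ p} (m%4≡2⇒2∣m p p%4≡2)) (∣ᵤ⇒∣ p∣Δ))

¬hasAntisymAbsInv⇒all≡2[mod4] : ∀ {r p q} .{{_ : NonZero q}} q′ M → p ∣ r → q ∣ r → q ≡ q′ * 2 →
  ¬ HasAntisymAbsInv r p q (M * 2) → (r % 4 ≡ 2) × (p % 4 ≡ 2) × (q % 4 ≡ 2) × ((M * 2) % 4 ≡ 2)
¬hasAntisymAbsInv⇒all≡2[mod4] {r} {p} {q} q′ M p∣r q∣r q≡q′*2 none =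
  split (2 ∣? p) (2 ∣? (M * h))
  where
  h = q′ * (r / q)
  r≡h*2 : r ≡ h * 2
  r≡h*2 = r≡q′*[r/q]*2 q′ q∣r q≡q′*2
  construct : ¬ 2 ∣ p ⊎ 2 ∣ M * h → HasAntisymAbsInv r p q (M * 2)
  construct cond with ∃pairElem-p∣Δ p M h cond
  ... | y , p∣Δ = pairElem-hasAntisymAbsInv p q h q′ y r≡h*2 refl (divides q′ q≡q′*2) p∣Δ
  twiceOdd : ∀ m → ¬ 2 ∣ m → (m * 2) % 4 ≡ 2
  twiceOdd m = Equivalence.from ([m*2]%4≡2⇔¬2∣m m)
  split : Dec (2 ∣ p) → Dec (2 ∣ M * h) →
    (r % 4 ≡ 2) × (p % 4 ≡ 2) × (q % 4 ≡ 2) × ((M * 2) % 4 ≡ 2)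
  split (no p-odd) _ = ⊥-elim (none (construct (inj₁ p-odd)))
  split _ (yes 2∣Mh) = ⊥-elim (none (construct (inj₂ 2∣Mh)))
  split (yes (divides p′ p≡p′*2)) (no Mh-odd) = r%4≡2 , p%4≡2 , q%4≡2 , twiceOdd M M-odd
    where
    h-odd : ¬ 2 ∣ h
    h-odd 2∣h = Mh-odd (∣n⇒∣m*n M 2∣h)
    M-odd : ¬ 2 ∣ M
    M-odd 2∣M = Mh-odd (∣m⇒∣m*n h 2∣M)
    r%4≡2 : r % 4 ≡ 2
    r%4≡2 = subst (λ r → r % 4 ≡ 2) (sym r≡h*2) (twiceOdd h h-odd)
    q%4≡2 : q % 4 ≡ 2
    q%4≡2 = subst (λ q → q % 4 ≡ 2) (sym q≡q′*2)
                  (twiceOdd q′ (λ 2∣q′ → h-odd (∣m⇒∣m*n (r / q) 2∣q′)))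
    p%4≡2 : p % 4 ≡ 2
    p%4≡2 = subst (λ p → p % 4 ≡ 2) (sym p≡p′*2)
                  (twiceOdd p′ (half-divisor-odd {p′} {h} (subst₂ _∣_ p≡p′*2 r≡h*2 p∣r) h-odd))

¬hasAntisymAbsInv⇒obstruction : ∀ r p q n .{{_ : NonZero q}} → p ∣ r → q ∣ r →
  ¬ HasAntisymAbsInv r p q n → Obstruction r p q n
¬hasAntisymAbsInv⇒obstruction r p q n p∣r q∣r none with 2 ∣? q | 2 ∣? n
... | no q-odd | _ = inj₁ q-odd
... | yes _ | no n-odd = inj₂ (inj₁ n-odd)
... | yes (divides q′ q≡q′*2) | yes (divides M refl) =
  inj₂ (inj₂ (¬hasAntisymAbsInv⇒all≡2[mod4] q′ M p∣r q∣r q≡q′*2 none))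

proposition11p2 : (r p q n : ℕ) → .{{_ : NonZero r}} → .{{_ : NonZero p}} → .{{_ : NonZero q}} → .{{_ : NonZero n}}
    → p ∣ r → q ∣ r → (p * q) ∣ (r * n)
    → (¬ HasAntisymAbsInv r p q n)
    ⇔ ((¬ (2 ∣ q)) ⊎ (¬ (2 ∣ n)) ⊎ ((r % 4 ≡ 2) × (p % 4 ≡ 2) × (q % 4 ≡ 2) × (n % 4 ≡ 2)))
proposition11p2 r p q n p∣r q∣r _ =
  mk⇔ (¬hasAntisymAbsInv⇒obstruction r p q n p∣r q∣r) (obstruction⇒¬hasAntisymAbsInv r p q n q∣r)
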